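{- Let $\mathbf A=\langle A,\to,0\rangle$ be a finite $\mathbf{I}_{2,0}$-chain, with its elements labeled as $A=[-n,m]$ so that $-n\sqsubset -n+1\sqsubset\cdots\sqsubset -1\sqsubset 0\sqsubset 1\sqsubset\cdots\sqsubset m$ (the constant being labeled $0$). Then $a^\ast=a'$ for every $a\in A$.
   Context: A zroupoid is an algebra $\langle A,\to,0\rangle$ with binary $\to$ and constant $0$; $x':=x\to 0$. An implication zroupoid satisfies (I) $(x\to y)\to z\approx[(z'\to x)\to(y\to z)']'$ and $0''\approx 0$; $\mathbf{I}_{2,0}$ is the variety of implication zroupoids satisfying $x''\approx x$. For $x,y\in A$, $x\sqsubseteq y$ iff $(x\to y')'=x$; $x\sqsubset y$ means $x\sqsubseteq y$ and $x\ne y$. An $\mathbf{I}_{2,0}$-chain is a member of $\mathbf{I}_{2,0}$ on which $\sqsubseteq$ is a total order. With the labeling $A=[-n,m]$, define $p(x)=x-1$ if $x>-n$, $p(-n)=-n$, and $x^\ast$ recursively by $0^\ast=m$, $x^\ast=x$ for $x<0$, $x^\ast=p((p(x))^\ast)$ for $x>0$ (integer comparisons refer to the labels). -}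

module Defs where

open import Data.Nat using (ℕ; zero; suc; _+_)
open import Data.Fin using (Fin; toℕ; fromℕ; _↑ˡ_)
import Data.Fin as F
open import Data.Integer as ℤ using (ℤ; +_; -[1+_]; _-_; -_)
open import Data.Product using (_×_)
open import Relation.Nullary using (does)
open import Data.Bool using (if_then_else_)
open import Relation.Binary.PropositionalEquality using (_≡_)

-- A finite algebra labeled by the integer interval [-n, m]:
-- carrier Fin (suc (n + m)), the element with index i has label i - n.
Carrier : ℕ → ℕ → Set
Carrier n m = Fin (suc (n + m))

lab : (n m : ℕ) → Carrier n m → ℤ
lab n m i = + toℕ i - + n

zeroEl : (n m : ℕ) → Carrier n m
zeroEl n m = fromℕ n ↑ˡ m

record IsLabeledI20Chain (n m : ℕ) (_⇒_ : Carrier n m → Carrier n m → Carrier n m) : Set where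
  private
    𝟘 = zeroEl n m
    _′ : Carrier n m → Carrier n m
    x ′ = x ⇒ 𝟘
  field
    identityI : ∀ x y z → (x ⇒ y) ⇒ z ≡ ((((z ′) ⇒ x) ⇒ ((y ⇒ z) ′)) ′)
    zero′′    : (𝟘 ′) ′ ≡ 𝟘
    involutive : ∀ x → (x ′) ′ ≡ x
    -- x ⊑ y  (i.e. (x → y')' = x)  iff  label x ≤ label y
    ⊑⇒≤ : ∀ x y → (x ⇒ (y ′)) ′ ≡ x → x F.≤ y
    ≤⇒⊑ : ∀ x y → x F.≤ y → (x ⇒ (y ′)) ′ ≡ x

pred* : ℕ → ℤ → ℤ
pred* n x = if does ((- + n) ℤ.<? x) then x - + 1 else - + n

-- x* on labels: 0* = m, x* = x for x < 0, x* = p((p x)*) for x > 0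
-- (for x = k+1 > 0 we have p x = k since k+1 > -n)
star : ℕ → ℕ → ℤ → ℤ
star n m (+ zero)  = + m
star n m (+ suc k) = pred* n (star n m (+ k))
star n m -[1+ k ]  = -[1+ k ]

-- Besides
--     1 → x = x for 1 = 0′, the key one is that the meet x ∧ y = (x → y′)′ is
--     commutative on ⊑-comparable pairs: y ⊑ x implies x → y′ = y′.  From these,
--     0 → x = 1 for 0 ⊑ x, complementation maps the positive cone {x | 0 ⊑ x} into
--     itself and reverses its order, and below 0 it satisfies a cancellation law.
-- (2) A counting fact about ℕ (reflection): a strictly decreasing self-map of an
--     interval [lo, hi] is k ↦ lo + hi - k; transferred to finite chains Fin (suc N).
-- (3) In a labeled chain (module Chain) complementation fixes every negative element
--     (by totality and the cancellation law) and is strictly antitone on the positive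
--     cone, hence acts there as the reflection of [0, m].  Comparing with the
--     recursive definition of star (identity on negatives, k ↦ m - k on [0, m])
--     gives the theorem.
module Submission where

open import Defs
open import Data.Nat as ℕ using (ℕ; zero; suc; _+_; _∸_; z≤n; s≤s)
import Data.Nat.Properties as ℕP
open import Data.Nat.DivMod using (_mod_; m<n⇒m%n≡m)
open import Data.Nat.Tactic.RingSolver using (solve-∀)
open import Data.Fin as F using (Fin; toℕ)
import Data.Fin.Properties as FP
open import Data.Integer as ℤ using (+_; -[1+_]; _⊖_)
import Data.Integer.Properties as ℤP
open import Data.Product using (_×_; _,_; ∃; proj₁; proj₂)
open import Data.Sum using (inj₁; inj₂)
open import Relation.Nullary using (yes; no; ¬_)
open import Relation.Nullary.Decidable using (dec-true)
open import Relation.Binary.PropositionalEquality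

module I20 {A : Set} (_⇒_ : A → A → A) (𝟘 : A)
  (identityI : ∀ x y z → (x ⇒ y) ⇒ z ≡ ((((z ⇒ 𝟘) ⇒ x) ⇒ ((y ⇒ z) ⇒ 𝟘)) ⇒ 𝟘))
  (involutive : ∀ x → (x ⇒ 𝟘) ⇒ 𝟘 ≡ x) where

  open ≡-Reasoning

  infix 30 _′
  _′ : A → A
  x ′ = x ⇒ 𝟘

  𝟙 : A
  𝟙 = 𝟘 ′

  infix 4 _⊑_
  _⊑_ : A → A → Set
  x ⊑ y = (x ⇒ y ′) ′ ≡ x

  ′-injective : ∀ {x y} → x ′ ≡ y ′ → x ≡ y
  ′-injective {x} {y} e = trans (sym (involutive x)) (trans (cong _′ e) (involutive y))

  ⊑-unfold : ∀ {x y} → x ⊑ y → x ⇒ y ′ ≡ x ′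
  ⊑-unfold p = trans (sym (involutive _)) (cong _′ p)

  -- 1 = 0′ is a left unit: instance (I) with y = z = 0.
  𝟙⇒ : ∀ x → 𝟙 ⇒ x ≡ x
  𝟙⇒ x = begin
    𝟙 ⇒ x                         ≡⟨ sym (involutive _) ⟩
    ((𝟙 ⇒ x) ⇒ 𝟘) ′               ≡⟨ cong (λ u → ((𝟙 ⇒ x) ⇒ u) ′) (sym (involutive 𝟘)) ⟩
    ((𝟙 ⇒ x) ⇒ (𝟘 ⇒ 𝟘) ′) ′       ≡⟨ sym (identityI x 𝟘 𝟘) ⟩
    x ′ ′                         ≡⟨ involutive x ⟩
    x                             ∎

  -- Instance (I) with x = y = 0, after cancelling the unit 1 and double primes.
  absorb : ∀ z → z ⇒ (𝟘 ⇒ z) ′ ≡ z ′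
  absorb z = sym (begin
    z ′                           ≡⟨ cong _′ (sym (𝟙⇒ z)) ⟩
    ((𝟘 ⇒ 𝟘) ⇒ z) ′               ≡⟨ cong _′ (identityI 𝟘 𝟘 z) ⟩
    ((z ′ ′ ⇒ (𝟘 ⇒ z) ′) ′) ′     ≡⟨ involutive _ ⟩
    z ′ ′ ⇒ (𝟘 ⇒ z) ′             ≡⟨ cong (λ u → u ⇒ (𝟘 ⇒ z) ′) (involutive z) ⟩
    z ⇒ (𝟘 ⇒ z) ′                 ∎)

  -- The meet (x → y′)′ is commutative on comparable pairs: if y ⊑ x then x → y′ = y′.
  -- Write x = x′ → 0 and apply (I); the inner term y → x′ collapses to y′ by y ⊑ x.
  meet-comm : ∀ {x y} → y ⊑ x → x ⇒ y ′ ≡ y ′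
  meet-comm {x} {y} y⊑x = begin
    x ⇒ y ′                             ≡⟨ cong (_⇒ y ′) (sym (involutive x)) ⟩
    (x ′ ⇒ 𝟘) ⇒ y ′                     ≡⟨ identityI (x ′) 𝟘 (y ′) ⟩
    ((y ′ ′ ⇒ x ′) ⇒ (𝟘 ⇒ y ′) ′) ′     ≡⟨ cong (λ u → (u ⇒ (𝟘 ⇒ y ′) ′) ′) y′′⇒x′ ⟩
    (y ′ ⇒ (𝟘 ⇒ y ′) ′) ′               ≡⟨ cong _′ (absorb (y ′)) ⟩
    y ′ ′ ′                             ≡⟨ involutive (y ′) ⟩
    y ′                                 ∎
    where
    y′′⇒x′ : y ′ ′ ⇒ x ′ ≡ y ′
    y′′⇒x′ = trans (cong (_⇒ x ′) (involutive y)) (⊑-unfold y⊑x)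

  𝟘⇒-via-𝟙 : ∀ x → 𝟘 ⇒ x ≡ (x ⇒ 𝟙) ⇒ 𝟙
  𝟘⇒-via-𝟙 x = sym (begin
    (x ⇒ 𝟙) ⇒ 𝟙                   ≡⟨ identityI x 𝟙 𝟙 ⟩
    ((𝟙 ′ ⇒ x) ⇒ (𝟙 ⇒ 𝟙) ′) ′     ≡⟨ cong₂ (λ u v → ((u ⇒ x) ⇒ v ′) ′) (involutive 𝟘) (𝟙⇒ 𝟙) ⟩
    ((𝟘 ⇒ x) ⇒ 𝟙 ′) ′             ≡⟨ cong (λ u → ((𝟘 ⇒ x) ⇒ u) ′) (involutive 𝟘) ⟩
    (𝟘 ⇒ x) ′ ′                   ≡⟨ involutive _ ⟩
    𝟘 ⇒ x                         ∎)

  𝟘⇒positive : ∀ {x} → 𝟘 ⊑ x → 𝟘 ⇒ x ≡ 𝟙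
  𝟘⇒positive {x} 𝟘⊑x = begin
    𝟘 ⇒ x                         ≡⟨ 𝟘⇒-via-𝟙 x ⟩
    (x ⇒ 𝟙) ⇒ 𝟙                   ≡⟨ cong (_⇒ 𝟙) (meet-comm 𝟘⊑x) ⟩
    𝟙 ⇒ 𝟙                         ≡⟨ 𝟙⇒ 𝟙 ⟩
    𝟙                             ∎

  ′-positive : ∀ {x} → 𝟘 ⊑ x → 𝟘 ⊑ x ′
  ′-positive {x} 𝟘⊑x = begin
    (𝟘 ⇒ x ′ ′) ′                 ≡⟨ cong (λ u → (𝟘 ⇒ u) ′) (involutive x) ⟩
    (𝟘 ⇒ x) ′                     ≡⟨ cong _′ (𝟘⇒positive 𝟘⊑x) ⟩
    𝟙 ′                           ≡⟨ involutive 𝟘 ⟩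
    𝟘                             ∎

  ′-antitone-positive : ∀ {w v} → 𝟘 ⊑ w → w ⊑ v → v ′ ⊑ w ′
  ′-antitone-positive {w} {v} 𝟘⊑w w⊑v = begin
    (v ′ ⇒ w ′ ′) ′                     ≡⟨ cong (λ u → (v ′ ⇒ u) ′) (involutive w) ⟩
    (v ′ ⇒ w) ′                         ≡⟨ cong₂ (λ u z → (u ⇒ z) ′) (sym (cong _′ (involutive v))) (sym w′′) ⟩
    ((v ′ ′ ⇒ 𝟘) ⇒ (w ⇒ v ′) ′) ′       ≡⟨ sym (identityI 𝟘 w (v ′)) ⟩
    (𝟘 ⇒ w) ⇒ v ′                       ≡⟨ cong (_⇒ v ′) (𝟘⇒positive 𝟘⊑w) ⟩
    𝟙 ⇒ v ′                             ≡⟨ 𝟙⇒ (v ′) ⟩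
    v ′                                 ∎
    where
    w′′ : (w ⇒ v ′) ′ ≡ w
    w′′ = trans (cong _′ (⊑-unfold w⊑v)) (involutive w)

  ′-cancel-negative : ∀ {a d} → a ⊑ d → d ⊑ 𝟘 → d ′ ⊑ a ′ → a ′ ≡ d ′
  ′-cancel-negative {a} {d} a⊑d d⊑𝟘 d′⊑a′ = begin
    a ′                                 ≡⟨ sym (⊑-unfold a⊑d) ⟩
    a ⇒ d ′                             ≡⟨ cong (_⇒ d ′) (sym (𝟙⇒ a)) ⟩
    (𝟙 ⇒ a) ⇒ d ′                       ≡⟨ identityI 𝟙 a (d ′) ⟩
    ((d ′ ′ ⇒ 𝟙) ⇒ (a ⇒ d ′) ′) ′       ≡⟨ cong₂ (λ u z → ((u ⇒ 𝟙) ⇒ z) ′) (involutive d) a′′ ⟩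
    ((d ⇒ 𝟙) ⇒ a) ′                     ≡⟨ cong (λ u → (u ⇒ a) ′) (⊑-unfold d⊑𝟘) ⟩
    (d ′ ⇒ a) ′                         ≡⟨ cong (λ u → (d ′ ⇒ u) ′) (sym (involutive a)) ⟩
    (d ′ ⇒ a ′ ′) ′                     ≡⟨ d′⊑a′ ⟩
    d ′                                 ∎
    where
    a′′ : (a ⇒ d ′) ′ ≡ a
    a′′ = trans (cong _′ (⊑-unfold a⊑d)) (involutive a)

nonincreasing⇒antitone : (lo hi : ℕ) (s : ℕ → ℕ) →
  (∀ k → lo ℕ.≤ k → k ℕ.< hi → s (suc k) ℕ.≤ s k) →
  ∀ {i j} → lo ℕ.≤ i → i ℕ.≤ j → j ℕ.≤ hi → s j ℕ.≤ s i
nonincreasing⇒antitone lo hi s step {i} {j} lo≤i i≤j j≤hi =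
  subst (λ u → s u ℕ.≤ s i) (ℕP.m+[n∸m]≡n i≤j) (walk (j ∸ i) i lo≤i i+d≤hi)
  where
  i+d≤hi : i + (j ∸ i) ℕ.≤ hi
  i+d≤hi = subst (ℕ._≤ hi) (sym (ℕP.m+[n∸m]≡n i≤j)) j≤hi
  walk : ∀ d k → lo ℕ.≤ k → k + d ℕ.≤ hi → s (k + d) ℕ.≤ s k
  walk zero k _ _ = ℕP.≤-reflexive (cong s (ℕP.+-identityʳ k))
  walk (suc d) k lo≤k k+d≤hi =
    ℕP.≤-trans (subst (λ u → s u ℕ.≤ s (suc k)) (sym (ℕP.+-suc k d)) rest) (step k lo≤k k<hi)
    where
    k+d≤hi′ : suc k + d ℕ.≤ hi
    k+d≤hi′ = subst (ℕ._≤ hi) (ℕP.+-suc k d) k+d≤hi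
    k<hi : k ℕ.< hi
    k<hi = ℕP.<-≤-trans (ℕP.m≤m+n (suc k) d) k+d≤hi′
    rest : s (suc k + d) ℕ.≤ s (suc k)
    rest = walk d (suc k) (ℕP.m≤n⇒m≤1+n lo≤k) k+d≤hi′

-- A strictly decreasing self-map g of the interval [lo, hi] is the reflection
-- k ↦ lo + hi - k: the sum g k + k does not increase, and it is at most lo + hi
-- at the left end and at least lo + hi at the right end.
reflection : (lo hi : ℕ) (g : ℕ → ℕ) →
  (∀ k → lo ℕ.≤ k → k ℕ.≤ hi → lo ℕ.≤ g k × g k ℕ.≤ hi) →
  (∀ k → lo ℕ.≤ k → k ℕ.< hi → g (suc k) ℕ.< g k) →
  ∀ k → lo ℕ.≤ k → k ℕ.≤ hi → g k + k ≡ lo + hi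
reflection lo hi g bounds decreasing k lo≤k k≤hi = ℕP.≤-antisym upper lower
  where
  s : ℕ → ℕ
  s j = g j + j
  s-step : ∀ j → lo ℕ.≤ j → j ℕ.< hi → s (suc j) ℕ.≤ s j
  s-step j lo≤j j<hi =
    subst (ℕ._≤ s j) (sym (ℕP.+-suc (g (suc j)) j)) (ℕP.+-monoˡ-≤ j (decreasing j lo≤j j<hi))
  antitone : ∀ {i j} → lo ℕ.≤ i → i ℕ.≤ j → j ℕ.≤ hi → s j ℕ.≤ s i
  antitone = nonincreasing⇒antitone lo hi s s-step
  lo≤hi : lo ℕ.≤ hi
  lo≤hi = ℕP.≤-trans lo≤k k≤hi
  upper : s k ℕ.≤ lo + hi
  upper = ℕP.≤-trans (antitone ℕP.≤-refl lo≤k k≤hi)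
    (subst (s lo ℕ.≤_) (ℕP.+-comm hi lo) (ℕP.+-monoˡ-≤ lo (proj₂ (bounds lo ℕP.≤-refl lo≤hi))))
  lower : lo + hi ℕ.≤ s k
  lower = ℕP.≤-trans (ℕP.+-monoˡ-≤ hi (proj₁ (bounds hi lo≤hi ℕP.≤-refl)))
    (antitone lo≤k k≤hi ℕP.≤-refl)

-- The same statement for a self-map h of the finite chain Fin (suc N) on its upper
-- segment {i | lo ≤ i}; indices are read back into Fin by reduction modulo suc N.
reflection-Fin : ∀ {N} (lo : ℕ) (h : Fin (suc N) → Fin (suc N)) →
  (∀ i → lo ℕ.≤ toℕ i → lo ℕ.≤ toℕ (h i)) →
  (∀ i j → lo ℕ.≤ toℕ i → i F.< j → h j F.< h i) →
  ∀ i → lo ℕ.≤ toℕ i → toℕ (h i) + toℕ i ≡ lo + N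
reflection-Fin {N} lo h closed decreasing i lo≤i =
  subst (λ u → toℕ (h u) + toℕ i ≡ lo + N) (mod-toℕ i)
    (reflection lo N g bounds g-decreasing (toℕ i) lo≤i (ℕP.≤-pred (FP.toℕ<n i)))
  where
  toℕ-mod : ∀ {k} → k ℕ.≤ N → toℕ (k mod suc N) ≡ k
  toℕ-mod k≤N = trans (FP.toℕ-fromℕ< _) (m<n⇒m%n≡m (s≤s k≤N))
  mod-toℕ : ∀ j → toℕ j mod suc N ≡ j
  mod-toℕ j = FP.toℕ-injective (toℕ-mod (ℕP.≤-pred (FP.toℕ<n j)))
  g : ℕ → ℕ
  g k = toℕ (h (k mod suc N))
  bounds : ∀ k → lo ℕ.≤ k → k ℕ.≤ N → lo ℕ.≤ g k × g k ℕ.≤ N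
  bounds k lo≤k k≤N =
    closed _ (subst (lo ℕ.≤_) (sym (toℕ-mod k≤N)) lo≤k) , ℕP.≤-pred (FP.toℕ<n _)
  g-decreasing : ∀ k → lo ℕ.≤ k → k ℕ.< N → g (suc k) ℕ.< g k
  g-decreasing k lo≤k k<N = decreasing _ _ (subst (lo ℕ.≤_) (sym k-index) lo≤k)
    (subst₂ ℕ._<_ (sym k-index) (sym (toℕ-mod k<N)) (ℕP.n<1+n k))
    where
    k-index : toℕ (k mod suc N) ≡ k
    k-index = toℕ-mod (ℕP.<⇒≤ k<N)

reflected-index : ∀ {x n m k} → k ℕ.≤ m → x + (n + k) ≡ n + (n + m) → x ≡ n + (m ∸ k)
reflected-index {x} {n} {m} {k} k≤m e = ℕP.+-cancelʳ-≡ (n + k) x (n + (m ∸ k)) (begin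
  x + (n + k)                   ≡⟨ e ⟩
  n + (n + m)                   ≡⟨ cong (λ u → n + (n + u)) (sym (ℕP.m∸n+n≡m k≤m)) ⟩
  n + (n + ((m ∸ k) + k))       ≡⟨ shuffle n (m ∸ k) k ⟩
  n + (m ∸ k) + (n + k)         ∎)
  where
  open ≡-Reasoning
  shuffle : ∀ a b c → a + (a + (b + c)) ≡ a + b + (a + c)
  shuffle = solve-∀

lab-positive : ∀ {n m k} (x : Carrier n m) → toℕ x ≡ n + k → lab n m x ≡ + k
lab-positive {n} {m} {k} x x≡n+k = begin
  lab n m x                ≡⟨ ℤP.[+m]-[+n]≡m⊖n (toℕ x) n ⟩
  toℕ x ⊖ n                ≡⟨ cong₂ _⊖_ x≡n+k (sym (ℕP.+-identityʳ n)) ⟩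
  (n + k) ⊖ (n + 0)        ≡⟨ ℤP.+-cancelˡ-⊖ n k 0 ⟩
  k ⊖ 0                    ≡⟨ ℤP.⊖-≥ z≤n ⟩
  + k                      ∎
  where open ≡-Reasoning

lab-negative : ∀ {n m} (x : Carrier n m) → toℕ x ℕ.< n → ∃ λ d → lab n m x ≡ -[1+ d ]
lab-negative {n} {m} x x<n with ℕP.m≤n⇒∃[o]m+o≡n x<n
... | d , x+1+d≡n = d , (begin
  lab n m x                      ≡⟨ ℤP.[+m]-[+n]≡m⊖n (toℕ x) n ⟩
  toℕ x ⊖ n                      ≡⟨ cong₂ _⊖_ (sym (ℕP.+-identityʳ (toℕ x))) (sym (trans (ℕP.+-suc (toℕ x) d) x+1+d≡n)) ⟩
  (toℕ x + 0) ⊖ (toℕ x + suc d)  ≡⟨ ℤP.+-cancelˡ-⊖ (toℕ x) 0 (suc d) ⟩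
  0 ⊖ suc d                      ≡⟨ ℤP.⊖-< (s≤s z≤n) ⟩
  -[1+ d ]                       ∎)
  where open ≡-Reasoning

star-negative : ∀ {n m} (x : Carrier n m) → toℕ x ℕ.< n → star n m (lab n m x) ≡ lab n m x
star-negative x x<n with lab-negative x x<n
... | d , e = trans (cong (star _ _) e) (sym e)

pred*-positive : ∀ n o → pred* n (+ suc o) ≡ + o
pred*-positive n o rewrite dec-true (ℤ.- (+ n) ℤ.<? + suc o) (ℤP.≤-<-trans ℤP.neg-≤-pos (ℤ.+<+ (s≤s z≤n)))
  = trans (ℤP.[+m]-[+n]≡m⊖n (suc o) 1) (ℤP.⊖-≥ z≤n)

star-positive : ∀ n m k o → k + o ≡ m → star n m (+ k) ≡ + o
star-positive n m zero    o o≡m = cong +_ (sym o≡m)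
star-positive n m (suc k) o e   =
  trans (cong (pred* n) (star-positive n m k (suc o) (trans (ℕP.+-suc k o) e))) (pred*-positive n o)

module Chain {n m : ℕ} {_⇒_ : Carrier n m → Carrier n m → Carrier n m}
  (chain : IsLabeledI20Chain n m _⇒_) where

  open IsLabeledI20Chain chain
  open I20 _⇒_ (zeroEl n m) identityI involutive

  𝟘 : Carrier n m
  𝟘 = zeroEl n m

  toℕ-𝟘 : toℕ 𝟘 ≡ n
  toℕ-𝟘 = trans (FP.toℕ-↑ˡ (F.fromℕ n) m) (FP.toℕ-fromℕ n)

  -- On the negative part complementation preserves the order: by totality, the
  -- only alternative is reversal, which collapses to equality.
  ′-monotone-negative : ∀ {a d} → a F.≤ d → d F.≤ 𝟘 → a ′ F.≤ d ′
  ′-monotone-negative {a} {d} a≤d d≤𝟘 with FP.≤-total (a ′) (d ′)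
  ... | inj₁ a′≤d′ = a′≤d′
  ... | inj₂ d′≤a′ =
    FP.≤-reflexive (′-cancel-negative (≤⇒⊑ a d a≤d) (≤⇒⊑ d 𝟘 d≤𝟘) (≤⇒⊑ (d ′) (a ′) d′≤a′))

  below-𝟘 : ∀ {x : Carrier n m} → ¬ (𝟘 F.≤ x) → x F.≤ 𝟘
  below-𝟘 x≱𝟘 = ℕP.<⇒≤ (ℕP.≰⇒> x≱𝟘)

  -- The positive cone is closed under complementation, hence so is its complement.
  ′-negative : ∀ {a} → ¬ (𝟘 F.≤ a) → ¬ (𝟘 F.≤ a ′)
  ′-negative {a} a≱𝟘 𝟘≤a′ =
    a≱𝟘 (subst (𝟘 F.≤_) (involutive a) (⊑⇒≤ 𝟘 (a ′ ′) (′-positive (≤⇒⊑ 𝟘 (a ′) 𝟘≤a′))))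

  negative-fixed : ∀ {a} → ¬ (𝟘 F.≤ a) → a ′ ≡ a
  negative-fixed {a} a≱𝟘 with FP.≤-total a (a ′)
  ... | inj₁ a≤a′ = FP.≤-antisym
          (subst (a ′ F.≤_) (involutive a) (′-monotone-negative a≤a′ (below-𝟘 (′-negative a≱𝟘)))) a≤a′
  ... | inj₂ a′≤a = FP.≤-antisym a′≤a
          (subst (F._≤ a ′) (involutive a) (′-monotone-negative a′≤a (below-𝟘 a≱𝟘)))

  positive-index : ∀ {a : Carrier n m} → 𝟘 F.≤ a → n ℕ.≤ toℕ a
  positive-index {a} = subst (ℕ._≤ toℕ a) toℕ-𝟘

  index-positive : ∀ {a : Carrier n m} → n ℕ.≤ toℕ a → 𝟘 F.≤ a
  index-positive {a} = subst (ℕ._≤ toℕ a) (sym toℕ-𝟘)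

  ′-strictly-antitone : ∀ {i j} → 𝟘 F.≤ i → i F.< j → j ′ F.< i ′
  ′-strictly-antitone {i} {j} 𝟘≤i i<j = FP.≤∧≢⇒<
    (⊑⇒≤ (j ′) (i ′) (′-antitone-positive (≤⇒⊑ 𝟘 i 𝟘≤i) (≤⇒⊑ i j (ℕP.<⇒≤ i<j))))
    (λ j′≡i′ → ℕP.<⇒≢ i<j (cong toℕ (sym (′-injective j′≡i′))))

  positive-reflected : ∀ {a k} → 𝟘 F.≤ a → toℕ a ≡ n + k → k ℕ.≤ m × toℕ (a ′) ≡ n + (m ∸ k)
  positive-reflected {a} {k} 𝟘≤a a≡n+k =
    k≤m , reflected-index k≤m (subst (λ u → toℕ (a ′) + u ≡ n + (n + m)) a≡n+k sum)
    where
    sum : toℕ (a ′) + toℕ a ≡ n + (n + m)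
    sum = reflection-Fin n _′
      (λ i n≤i → positive-index (⊑⇒≤ 𝟘 (i ′) (′-positive (≤⇒⊑ 𝟘 i (index-positive n≤i)))))
      (λ i j n≤i i<j → ′-strictly-antitone (index-positive n≤i) i<j)
      a (positive-index 𝟘≤a)
    k≤m : k ℕ.≤ m
    k≤m = ℕP.+-cancelˡ-≤ n k m (ℕP.≤-pred (subst (ℕ._< suc (n + m)) a≡n+k (FP.toℕ<n a)))

  complement-negative : ∀ {a} → ¬ (𝟘 F.≤ a) → lab n m (a ′) ≡ star n m (lab n m a)
  complement-negative {a} a≱𝟘 = begin
    lab n m (a ′)            ≡⟨ cong (lab n m) (negative-fixed a≱𝟘) ⟩
    lab n m a                ≡⟨ sym (star-negative a a<n) ⟩
    star n m (lab n m a)     ∎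
    where
    open ≡-Reasoning
    a<n : toℕ a ℕ.< n
    a<n = ℕP.≰⇒> (λ n≤a → a≱𝟘 (index-positive n≤a))

  complement-positive : ∀ {a} → 𝟘 F.≤ a → lab n m (a ′) ≡ star n m (lab n m a)
  complement-positive {a} 𝟘≤a = begin
    lab n m (a ′)            ≡⟨ lab-positive (a ′) a′≡n+[m-k] ⟩
    + (m ∸ k)                ≡⟨ sym (star-positive n m k (m ∸ k) (ℕP.m+[n∸m]≡n k≤m)) ⟩
    star n m (+ k)           ≡⟨ cong (star n m) (sym (lab-positive {n} {m} a a≡n+k)) ⟩
    star n m (lab n m a)     ∎
    where
    open ≡-Reasoning
    k : ℕ
    k = toℕ a ∸ n
    a≡n+k : toℕ a ≡ n + k
    a≡n+k = sym (ℕP.m+[n∸m]≡n (positive-index 𝟘≤a))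
    k≤m : k ℕ.≤ m
    k≤m = proj₁ (positive-reflected 𝟘≤a a≡n+k)
    a′≡n+[m-k] : toℕ (a ′) ≡ n + (m ∸ k)
    a′≡n+[m-k] = proj₂ (positive-reflected 𝟘≤a a≡n+k)

lemma5p12 : (n m : ℕ) (_⇒_ : Carrier n m → Carrier n m → Carrier n m) →
    IsLabeledI20Chain n m _⇒_ →
    ∀ a → lab n m (a ⇒ zeroEl n m) ≡ star n m (lab n m a)
lemma5p12 n m _⇒_ chain a with zeroEl n m F.≤? a
... | yes 𝟘≤a = Chain.complement-positive chain 𝟘≤a
... | no  a≱𝟘 = Chain.complement-negative chain a≱𝟘
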